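{- For any monoid $M$, the variety $(\mathcal{G}_M,\mathcal{R}_M)$ of $M$-pigmented monoids is a presentation of the clone $\mathbf{P}(M)$; that is, $\mathbf{P}(M)$ is isomorphic as a clone to $\mathbf{T}(\mathcal{G}_M)/_{\equiv_{\mathcal{R}_M}}$.
   Context: An (abstract) clone $C$ is a graded set $C=\bigsqcup_{n\ge 0}C(n)$ with superposition maps $C(n)\times C(m)^n\to C(m)$, $(x,(y_1,\dots,y_n))\mapsto x[y_1,\dots,y_n]$, and projections $\mathbf{1}_{i,n}\in C(n)$ ($n\ge1$, $i\in[n]$) such that $\mathbf{1}_{i,n}[y_1,\dots,y_n]=y_i$, $x[\mathbf{1}_{1,n},\dots,\mathbf{1}_{n,n}]=x$ for $x\in C(n)$, and $x[y_1,\dots,y_n][z_1,\dots,z_m]=x[y_1[z_1,\dots,z_m],\dots,y_n[z_1,\dots,z_m]]$. Clone morphisms preserve arities, projections and superpositions; a clone congruence is an arity-preserving equivalence relation compatible with superposition, and quotients are defined accordingly. Pigmented words: let $(M,\cdot,e)$ be a monoid. An $M$-pigmented letter is a pair written $i^\alpha$ with $i$ a positive integer (its value) and $\alpha\in M$ (its pigment). For $n\ge0$, $\mathbf{P}(M)(n)$ is the set of finite words of $M$-pigmented letters all of whose values lie in $[n]$ (the empty word is $\epsilon$). For $\alpha\in M$ and $\mathfrak{p}=i_1^{\alpha_1}\cdots i_\ell^{\alpha_\ell}$ put $\alpha\odot\mathfrak{p}:=i_1^{\alpha\cdot\alpha_1}\cdots i_\ell^{\alpha\cdot\alpha_\ell}$.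 The clone $\mathbf{P}(M)$ has superposition $i_1^{\alpha_1}\cdots i_\ell^{\alpha_\ell}[\mathfrak{p}_1,\dots,\mathfrak{p}_n]:=(\alpha_1\odot\mathfrak{p}_{i_1})\cdots(\alpha_\ell\odot\mathfrak{p}_{i_\ell})$ (concatenation) and projections $\mathbf{1}_{i,n}:=i^e$. Terms and presentations: for a signature (graded set) $\mathcal{G}$, $\mathcal{G}$-terms are variables $x_1,x_2,\dots$ or $g[t_1,\dots,t_k]$ with $g\in\mathcal{G}(k)$ and $t_j$ terms; $\mathbf{T}(\mathcal{G})(n)$ is the set of terms with all variables in $\{x_1,\dots,x_n\}$; $\mathbf{T}(\mathcal{G})$ is the free clone, with superposition $t[t_1,\dots,t_n]$ the simultaneous substitution of $t_i$ for $x_i$ and projections $x_i$. A variety is a pair $(\mathcal{G},\mathcal{R})$ with $\mathcal{R}$ an equivalence relation on $\mathbf{T}(\mathcal{G})$; $\equiv_{\mathcal{R}}$ is the smallest clone congruence of $\mathbf{T}(\mathcal{G})$ containing $\mathcal{R}$; $(\mathcal{G},\mathcal{R})$ is a presentation of a clone $C$ if $C\cong \mathbf{T}(\mathcal{G})/_{\equiv_{\mathcal{R}}}$. The variety of $M$-pigmented monoids: $\mathcal{G}_M(0)=\{\mathsf{u}\}$, $\mathcal{G}_M(1)=\{\mathsf{p}_\alpha:\alpha\in M\}$, $\mathcal{G}_M(2)=\{\star\}$, and $\mathcal{R}_M$ is the equivalence relation on $\mathbf{T}(\mathcal{G}_M)$ generated by, for all $\alpha,\alpha_1,\alpha_2\in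 M$: $\star[\star[x_1,x_2],x_3]\sim\star[x_1,\star[x_2,x_3]]$; $\star[\mathsf{u},x_1]\sim x_1\sim\star[x_1,\mathsf{u}]$; $\mathsf{p}_\alpha[\star[x_1,x_2]]\sim\star[\mathsf{p}_\alpha[x_1],\mathsf{p}_\alpha[x_2]]$; $\mathsf{p}_\alpha[\mathsf{u}]\sim\mathsf{u}$; $\mathsf{p}_{\alpha_1}[\mathsf{p}_{\alpha_2}[x_1]]\sim\mathsf{p}_{\alpha_1\cdot\alpha_2}[x_1]$; $\mathsf{p}_e[x_1]\sim x_1$. -}

module Defs where

open import Level using (_⊔_)
open import Data.Nat using (ℕ)
open import Data.Fin using (Fin; zero; suc)
open import Data.Product using (Σ; ∃; _×_; _,_)
open import Data.List using (List; []; _∷_; map; concatMap)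
open import Data.List.Relation.Binary.Pointwise using (Pointwise)
open import Relation.Binary.PropositionalEquality using (_≡_)
open import Algebra.Bundles using (Monoid)

module Pigmented {c ℓ} (M : Monoid c ℓ) where
  open Monoid M using (Carrier; _≈_; _∙_; ε)

  -- The clone P(M) of M-pigmented words.
  -- A letter i^α with value i ∈ [n] is represented as (i , α) : Fin n × Carrier.
  Letter : ℕ → Set c
  Letter n = Fin n × Carrier

  Word : ℕ → Set c
  Word n = List (Letter n)

  LetterEq : ∀ {n} → Letter n → Letter n → Set ℓ
  LetterEq (i , α) (j , β) = (i ≡ j) × (α ≈ β)

  infix 4 _≋_
  _≋_ : ∀ {n} → Word n → Word n → Set (c ⊔ ℓ)
  _≋_ = Pointwise LetterEq

  _⊙_ : ∀ {n} → Carrier → Word n → Word n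
  α ⊙ w = map (λ { (i , β) → (i , α ∙ β) }) w

  _⟦_⟧ : ∀ {n m} → Word n → (Fin n → Word m) → Word m
  w ⟦ ps ⟧ = concatMap (λ { (i , α) → α ⊙ ps i }) w

  proj : ∀ {n} → Fin n → Word n
  proj i = (i , ε) ∷ []

  data Term (n : ℕ) : Set c where
    var : Fin n → Term n
    u   : Term n
    p   : Carrier → Term n → Term n
    ⋆   : Term n → Term n → Term n

  _⟪_⟫ : ∀ {n m} → Term n → (Fin n → Term m) → Term m
  var i   ⟪ σ ⟫ = σ i
  u       ⟪ σ ⟫ = u
  p α t   ⟪ σ ⟫ = p α (t ⟪ σ ⟫)
  ⋆ t t'  ⟪ σ ⟫ = ⋆ (t ⟪ σ ⟫) (t' ⟪ σ ⟫)

  private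
    x₁ : ∀ {n} → Term (Data.Nat.suc n)
    x₁ = var zero
    x₂ : ∀ {n} → Term (Data.Nat.suc (Data.Nat.suc n))
    x₂ = var (suc zero)
    x₃ : ∀ {n} → Term (Data.Nat.suc (Data.Nat.suc (Data.Nat.suc n)))
    x₃ = var (suc (suc zero))

  -- Generating pairs of R_M (each in the least arity containing its variables;
  -- the congruence below transports them to all arities via superposition).
  -- pcong: the unary symbols are indexed by the setoid M, so p_α and p_β are
  -- the same symbol when α ≈ β.
  data Gen : ∀ {n} → Term n → Term n → Set (c ⊔ ℓ) where
    assoc  : Gen {3} (⋆ (⋆ x₁ x₂) x₃) (⋆ x₁ (⋆ x₂ x₃))
    unitˡ  : Gen {1} (⋆ u x₁) x₁
    unitʳ  : Gen {1} (⋆ x₁ u) x₁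
    pdist  : ∀ α → Gen {2} (p α (⋆ x₁ x₂)) (⋆ (p α x₁) (p α x₂))
    punit  : ∀ α → Gen {0} (p α u) u
    pcomp  : ∀ α₁ α₂ → Gen {1} (p α₁ (p α₂ x₁)) (p (α₁ ∙ α₂) x₁)
    pid    : Gen {1} (p ε x₁) x₁
    pcong  : ∀ {α β} → α ≈ β → Gen {1} (p α x₁) (p β x₁)

  infix 4 _≡R_
  data _≡R_ : ∀ {n} → Term n → Term n → Set (c ⊔ ℓ) where
    gen   : ∀ {n} {t t' : Term n} → Gen t t' → t ≡R t'
    refl  : ∀ {n} {t : Term n} → t ≡R t
    sym   : ∀ {n} {t t' : Term n} → t ≡R t' → t' ≡R t
    trans : ∀ {n} {t t' t'' : Term n} → t ≡R t' → t' ≡R t'' → t ≡R t''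
    sup   : ∀ {n m} {t t' : Term n} {σ σ' : Fin n → Term m} →
            t ≡R t' → (∀ i → σ i ≡R σ' i) → (t ⟪ σ ⟫) ≡R (t' ⟪ σ' ⟫)

  -- A clone isomorphism T(G_M)/≡R ≅ P(M), presented via a map on
  -- representatives: φ is a clone morphism T(G_M) → P(M) (preserves projections
  -- and superposition, up to ≋), whose kernel is exactly ≡R, and which is
  -- surjective up to ≋. This is precisely an isomorphism of the quotient clone.
  record PresentationIso : Set (c ⊔ ℓ) where
    field
      φ        : ∀ {n} → Term n → Word n
      φ-proj   : ∀ {n} (i : Fin n) → φ (var i) ≋ proj i
      φ-sup    : ∀ {n m} (t : Term n) (σ : Fin n → Term m) →
                 φ (t ⟪ σ ⟫) ≋ (φ t ⟦ (λ i → φ (σ i)) ⟧)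
      φ-resp   : ∀ {n} {t t' : Term n} → t ≡R t' → φ t ≋ φ t'
      φ-refl   : ∀ {n} {t t' : Term n} → φ t ≋ φ t' → t ≡R t'
      φ-surj   : ∀ {n} (w : Word n) → Σ (Term n) (λ t → φ t ≋ w)

{-# OPTIONS --safe #-}

-- Reading u as the empty word, ⋆ as concatenation and p_α as α ⊙ – turns a term
-- into a pigmented word; this is a clone morphism, and every relation of R_M
-- holds between words, so it factors through ≡R. Conversely the relations
-- suffice to rewrite any term into the normal form ⋆[p_α₁[x_i₁], ⋆[…, u]] of its
-- word, so two terms with the same word are ≡R-equivalent, and normal forms
-- realise every word.

module Submission where

open import Defs
open import Level using (_⊔_)
open import Algebra.Bundles using (Monoid)
open import Data.Nat using (ℕ)
open import Data.Fin using (Fin; zero; suc)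
open import Data.Product using (_,_)
open import Data.List using ([]; _∷_; _++_; concat; map)
open import Data.List.Properties using (map-++; concat-++; ++-identityʳ)
open import Data.List.Relation.Binary.Pointwise as Pointwise using ([]; _∷_)
open import Data.Vec.Functional using () renaming ([] to []ᵥ; _∷_ to _∷ᵥ_)
open import Relation.Binary.Bundles using (Setoid)
open import Relation.Binary.Structures using (IsEquivalence)
import Relation.Binary.PropositionalEquality as ≡
import Relation.Binary.Reasoning.Setoid as SetoidReasoning

module PigmentedPresentation {c ℓ} (M : Monoid c ℓ) where
  module M = Monoid M
  open M using (_≈_; _∙_; ε)
  open Pigmented M

  letterEq-isEquivalence : ∀ {n} → IsEquivalence (LetterEq {n})
  letterEq-isEquivalence = record
    { refl  = ≡.refl , M.refl
    ; sym   = λ (i≡j , α≈β) → ≡.sym i≡j , M.sym α≈β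
    ; trans = λ (i≡j , α≈β) (j≡k , β≈γ) → ≡.trans i≡j j≡k , M.trans α≈β β≈γ
    }

  wordSetoid : ℕ → Setoid c (c ⊔ ℓ)
  wordSetoid n = record
    { isEquivalence = Pointwise.isEquivalence (letterEq-isEquivalence {n}) }

  module _ {n : ℕ} where
    open Setoid (wordSetoid n) public
      using () renaming (refl to ≋-refl; sym to ≋-sym; trans to ≋-trans; reflexive to ≡⇒≋)

  ++-cong : ∀ {n} {v v' w w' : Word n} → v ≋ v' → w ≋ w' → v ++ w ≋ v' ++ w'
  ++-cong = Pointwise.++⁺

  ⊙-cong : ∀ {n} {α β} {w w' : Word n} → α ≈ β → w ≋ w' → α ⊙ w ≋ β ⊙ w'
  ⊙-cong α≈β []                   = []
  ⊙-cong α≈β ((i≡j , γ≈δ) ∷ w≋w') = (i≡j , M.∙-cong α≈β γ≈δ) ∷ ⊙-cong α≈β w≋w'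

  ⊙-identityˡ : ∀ {n} (w : Word n) → ε ⊙ w ≋ w
  ⊙-identityˡ []            = []
  ⊙-identityˡ ((i , γ) ∷ w) = (≡.refl , M.identityˡ γ) ∷ ⊙-identityˡ w

  ⊙-∙ : ∀ {n} α β (w : Word n) → α ⊙ (β ⊙ w) ≋ (α ∙ β) ⊙ w
  ⊙-∙ α β []            = []
  ⊙-∙ α β ((i , γ) ∷ w) = (≡.refl , M.sym (M.assoc α β γ)) ∷ ⊙-∙ α β w

  ⊙-++ : ∀ {n} α (v w : Word n) → α ⊙ (v ++ w) ≡.≡ (α ⊙ v) ++ (α ⊙ w)
  ⊙-++ α = map-++ _

  ⟦⟧-++ : ∀ {n m} (v w : Word n) (ps : Fin n → Word m) →
          (v ++ w) ⟦ ps ⟧ ≡.≡ (v ⟦ ps ⟧) ++ (w ⟦ ps ⟧)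
  ⟦⟧-++ v w ps = ≡.trans (≡.cong concat (map-++ f v w)) (≡.sym (concat-++ (map f v) (map f w)))
    where
    f : Letter _ → Word _
    f (i , α) = α ⊙ ps i

  ⟦⟧-⊙ : ∀ {n m} α (w : Word n) (ps : Fin n → Word m) →
         (α ⊙ w) ⟦ ps ⟧ ≋ α ⊙ (w ⟦ ps ⟧)
  ⟦⟧-⊙ α []            ps = []
  ⟦⟧-⊙ α ((i , β) ∷ w) ps = begin
    ((α ∙ β) ⊙ ps i) ++ ((α ⊙ w) ⟦ ps ⟧)  ≈⟨ ++-cong (≋-sym (⊙-∙ α β (ps i))) (⟦⟧-⊙ α w ps) ⟩
    (α ⊙ (β ⊙ ps i)) ++ (α ⊙ (w ⟦ ps ⟧))  ≡⟨ ⊙-++ α (β ⊙ ps i) (w ⟦ ps ⟧) ⟨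
    α ⊙ ((β ⊙ ps i) ++ (w ⟦ ps ⟧))        ∎
    where open SetoidReasoning (wordSetoid _)

  ⟦⟧-cong : ∀ {n m} {w w' : Word n} {ps ps' : Fin n → Word m} →
            w ≋ w' → (∀ i → ps i ≋ ps' i) → w ⟦ ps ⟧ ≋ w' ⟦ ps' ⟧
  ⟦⟧-cong []                      ps≋ps' = []
  ⟦⟧-cong ((≡.refl , α≈β) ∷ w≋w') ps≋ps' =
    ++-cong (⊙-cong α≈β (ps≋ps' _)) (⟦⟧-cong w≋w' ps≋ps')

  toWord : ∀ {n} → Term n → Word n
  toWord (var i)  = proj i
  toWord u        = []
  toWord (p α t)  = α ⊙ toWord t
  toWord (⋆ t t') = toWord t ++ toWord t'

  toWord-⟪⟫ : ∀ {n m} (t : Term n) (σ : Fin n → Term m) →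
              toWord (t ⟪ σ ⟫) ≋ toWord t ⟦ (λ i → toWord (σ i)) ⟧
  toWord-⟪⟫ (var i) σ = ≋-sym (≋-trans (≡⇒≋ (++-identityʳ _)) (⊙-identityˡ _))
  toWord-⟪⟫ u σ = []
  toWord-⟪⟫ (p α t) σ =
    ≋-trans (⊙-cong M.refl (toWord-⟪⟫ t σ)) (≋-sym (⟦⟧-⊙ α (toWord t) _))
  toWord-⟪⟫ (⋆ t t') σ =
    ≋-trans (++-cong (toWord-⟪⟫ t σ) (toWord-⟪⟫ t' σ)) (≡⇒≋ (≡.sym (⟦⟧-++ (toWord t) (toWord t') _)))

  toWord-gen : ∀ {n} {t t' : Term n} → Gen t t' → toWord t ≋ toWord t'
  toWord-gen assoc          = ≋-refl
  toWord-gen unitˡ          = ≋-refl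
  toWord-gen unitʳ          = ≋-refl
  toWord-gen (pdist α)      = ≋-refl
  toWord-gen (punit α)      = ≋-refl
  toWord-gen (pcomp α₁ α₂)  = ⊙-∙ α₁ α₂ _
  toWord-gen pid            = ⊙-identityˡ _
  toWord-gen (pcong α≈β)    = ⊙-cong α≈β ≋-refl

  toWord-resp : ∀ {n} {t t' : Term n} → t ≡R t' → toWord t ≋ toWord t'
  toWord-resp (gen g)       = toWord-gen g
  toWord-resp refl          = ≋-refl
  toWord-resp (sym r)       = ≋-sym (toWord-resp r)
  toWord-resp (trans r r')  = ≋-trans (toWord-resp r) (toWord-resp r')
  toWord-resp (sup {t = t} {t'} {σ} {σ'} r σ≡Rσ') = begin
    toWord (t ⟪ σ ⟫)                         ≈⟨ toWord-⟪⟫ t σ ⟩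
    toWord t ⟦ (λ i → toWord (σ i)) ⟧        ≈⟨ ⟦⟧-cong (toWord-resp r) (λ i → toWord-resp (σ≡Rσ' i)) ⟩
    toWord t' ⟦ (λ i → toWord (σ' i)) ⟧      ≈⟨ toWord-⟪⟫ t' σ' ⟨
    toWord (t' ⟪ σ' ⟫)                       ∎
    where open SetoidReasoning (wordSetoid _)

  gen⟪_⟫ : ∀ {k n} {t t' : Term k} → Gen t t' → (σ : Fin k → Term n) → t ⟪ σ ⟫ ≡R t' ⟪ σ ⟫
  gen⟪ g ⟫ σ = sup (gen g) (λ _ → refl)

  ⋆-cong : ∀ {n} {a a' b b' : Term n} → a ≡R a' → b ≡R b' → ⋆ a b ≡R ⋆ a' b'
  ⋆-cong {a = a} {a'} {b} {b'} a≡Ra' b≡Rb' =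
    sup {t = ⋆ (var zero) (var (suc zero))} {σ = a ∷ᵥ b ∷ᵥ []ᵥ} {σ' = a' ∷ᵥ b' ∷ᵥ []ᵥ} refl
      λ { zero → a≡Ra' ; (suc zero) → b≡Rb' }

  p-cong : ∀ {n} {α} {a a' : Term n} → a ≡R a' → p α a ≡R p α a'
  p-cong {α = α} {a} {a'} a≡Ra' =
    sup {t = p α (var zero)} {σ = a ∷ᵥ []ᵥ} {σ' = a' ∷ᵥ []ᵥ} refl (λ { zero → a≡Ra' })

  normalForm : ∀ {n} → Word n → Term n
  normalForm []            = u
  normalForm ((i , α) ∷ w) = ⋆ (p α (var i)) (normalForm w)

  toWord-normalForm : ∀ {n} (w : Word n) → toWord (normalForm w) ≋ w
  toWord-normalForm []            = []
  toWord-normalForm ((i , α) ∷ w) = (≡.refl , M.identityʳ α) ∷ toWord-normalForm w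

  normalForm-resp : ∀ {n} {w w' : Word n} → w ≋ w' → normalForm w ≡R normalForm w'
  normalForm-resp []                      = refl
  normalForm-resp ((≡.refl , α≈β) ∷ w≋w') =
    ⋆-cong (gen⟪ pcong α≈β ⟫ (var _ ∷ᵥ []ᵥ)) (normalForm-resp w≋w')

  normalForm-⊙ : ∀ {n} α (w : Word n) → p α (normalForm w) ≡R normalForm (α ⊙ w)
  normalForm-⊙ α []            = gen⟪ punit α ⟫ []ᵥ
  normalForm-⊙ α ((i , β) ∷ w) =
    trans (gen⟪ pdist α ⟫ (p β (var i) ∷ᵥ normalForm w ∷ᵥ []ᵥ))
          (⋆-cong (gen⟪ pcomp α β ⟫ (var i ∷ᵥ []ᵥ)) (normalForm-⊙ α w))

  normalForm-++ : ∀ {n} (v w : Word n) → ⋆ (normalForm v) (normalForm w) ≡R normalForm (v ++ w)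
  normalForm-++ []            w = gen⟪ unitˡ ⟫ (normalForm w ∷ᵥ []ᵥ)
  normalForm-++ ((i , α) ∷ v) w =
    trans (gen⟪ assoc ⟫ (p α (var i) ∷ᵥ normalForm v ∷ᵥ normalForm w ∷ᵥ []ᵥ))
          (⋆-cong refl (normalForm-++ v w))

  ≡R-normalForm : ∀ {n} (t : Term n) → t ≡R normalForm (toWord t)
  ≡R-normalForm (var i)  =
    sym (trans (gen⟪ unitʳ ⟫ (p ε (var i) ∷ᵥ []ᵥ)) (gen⟪ pid ⟫ (var i ∷ᵥ []ᵥ)))
  ≡R-normalForm u        = refl
  ≡R-normalForm (p α t)  = trans (p-cong (≡R-normalForm t)) (normalForm-⊙ α (toWord t))
  ≡R-normalForm (⋆ t t') =
    trans (⋆-cong (≡R-normalForm t) (≡R-normalForm t')) (normalForm-++ (toWord t) (toWord t'))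

  toWord-reflects : ∀ {n} {t t' : Term n} → toWord t ≋ toWord t' → t ≡R t'
  toWord-reflects {t = t} {t'} w≋w' =
    trans (≡R-normalForm t) (trans (normalForm-resp w≋w') (sym (≡R-normalForm t')))

theorem3p3p6 : ∀ {c ℓ} (M : Monoid c ℓ) → Pigmented.PresentationIso M
theorem3p3p6 M = record
  { φ      = toWord
  ; φ-proj = λ i → ≋-refl
  ; φ-sup  = toWord-⟪⟫
  ; φ-resp = toWord-resp
  ; φ-refl = toWord-reflects
  ; φ-surj = λ w → normalForm w , toWord-normalForm w
  }
  where open PigmentedPresentation M
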